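{- Let $n\ge1$, $C\in\mathbb{N}$ and let $a_1,\ldots,a_{3n}$ be nonnegative integers with $\frac{C}{4}<a_i<\frac{C}{2}$ for all $i$ and $\sum_{i=1}^{3n}a_i=nC$. Let $\lambda>3n$ be an integer and $$P_\lambda(q)=n q^{\lambda C+1}+\sum_{i=1}^{3n} q^{\lambda C+1+\lambda a_i}+\sum_{i=1}^{3n}(\lambda a_i-1)q^{\lambda C+\lambda a_i+2}.$$ Let $T$ be a rooted tree with $Av_T(q)=P_\lambda(q)$, and let $L$ be the set of vertices of $T$ whose label is of the form $\lambda C+\lambda a_i+2$ for some $i$. Then every vertex of $L$ is a leaf of $T$.
   Context: Let $T$ be a finite tree rooted at a vertex $r$. For a vertex $v$, the maximal subtree rooted at $v$ consists of $v$ and all its descendants; its size is its number of vertices. The vertices of $T$ are labeled as follows: the root is labeled $0$, and a child $v$ of a vertex labeled $\mu$ is labeled $\mu + |\text{maximal subtree rooted at } v|$. The avalanche polynomial of $T$ is $Av_T(q)=\sum_{i\ge 1} p_i q^i$, where $p_i$ is the number of vertices of $T$ labeled $i$. A leaf is a non-root vertex with no children. -}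

module Defs where

open import Data.Nat using (ℕ; zero; suc; _+_; _*_; _∸_; _≡ᵇ_)
open import Data.Nat.Properties using (_≟_)
open import Data.Bool using (if_then_else_)
open import Data.List using (List; []; _∷_; map; _++_; length; filter)
open import Data.Nat.ListAction using (sum)
open import Data.List.Membership.Propositional using (_∈_)
open import Data.List.Relation.Unary.Any using (here; there)
open import Data.Fin using (Fin)
open import Data.Empty using (⊥)
open import Data.Unit using (⊤)
open import Relation.Binary.PropositionalEquality using (_≡_; refl)
import Data.List as List

data Tree : Set where
  node : List Tree → Tree

children : Tree → List Tree
children (node ts) = ts

mutual
  size : Tree → ℕ
  size (node ts) = suc (sizes ts)

  sizes : List Tree → ℕ
  sizes []       = 0
  sizes (t ∷ ts) = size t + sizes ts

-- Vertices of a tree, as positions (paths from the root).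
data Pos : Tree → Set where
  root  : ∀ {ts} → Pos (node ts)
  child : ∀ {ts t} → t ∈ ts → Pos t → Pos (node ts)

subtree : ∀ {t} → Pos t → Tree
subtree {t} root  = t
subtree (child _ p) = subtree p

labelFrom : ∀ {t} → ℕ → Pos t → ℕ
labelFrom μ root = μ
labelFrom {node ts} μ (child {t = t} _ p) = labelFrom (μ + size t) p

label : ∀ {t} → Pos t → ℕ
label = labelFrom 0

NonRoot : ∀ {t} → Pos t → Set
NonRoot root        = ⊥
NonRoot (child _ _) = ⊤

IsLeaf : ∀ {t} → Pos t → Set
IsLeaf p = NonRoot p Data.Product.× (children (subtree p) ≡ [])
  where import Data.Product

mutual
  allPos : (t : Tree) → List (Pos t)
  allPos (node ts) = root ∷ allPosL ts child

  allPosL : {A : Set} (ts : List Tree) → (∀ {t} → t ∈ ts → Pos t → A) → List A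
  allPosL []       f = []
  allPosL (t ∷ ts) f = map (f (here refl)) (allPos t) ++ allPosL ts (λ m → f (there m))

-- coefficient p_i of the avalanche polynomial: number of vertices labelled i
avCoeff : Tree → ℕ → ℕ
avCoeff t i = length (filter (λ p → label p ≟ i) (allPos t))

ΣFin : (m : ℕ) → (Fin m → ℕ) → ℕ
ΣFin m f = sum (List.tabulate f)

-- coefficient of q^i in
-- P_λ(q) = n q^{λC+1} + Σ_i q^{λC+1+λ a_i} + Σ_i (λ a_i - 1) q^{λC+λ a_i+2}
PCoeff : (n C : ℕ) → (Fin (3 * n) → ℕ) → (lam : ℕ) → ℕ → ℕ
PCoeff n C a lam i =
  (if i ≡ᵇ (lam * C + 1) then n else 0)
  + ΣFin (3 * n) (λ j → if i ≡ᵇ (lam * C + 1 + lam * a j) then 1 else 0)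
  + ΣFin (3 * n) (λ j → if i ≡ᵇ (lam * C + lam * a j + 2) then (lam * a j ∸ 1) else 0)

module Submission where

-- Write m = λC + 1, X_j = m + λa_j and Y_j = X_j + 1 for the exponents of P_λ.
-- Every non-root vertex is labelled by one of them (comparison of
-- coefficients), and summing a weight g over the labels of all vertices can be
-- read off from P_λ (double counting, 'total-weight').  With g marking labels
-- ≡ 1 (mod λ) and h marking the label m this gives 4n and n respectively.
-- Root children are labelled by their size, hence the n vertices labelled m
-- are root children of size m; such a child has exactly three children of
-- sizes λa_j (sizes lie strictly between λC/4 and λC/2 and sum to λC), so its
-- top two layers already carry g-weight 4.  Comparing the totals 4n = 4n
-- forces g to vanish everywhere else, in particular on every child of a
-- non-root vertex not labelled m ('below-non-m').  Then a child w of a vertex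
-- labelled Y_i is labelled Y_k with λ ∣ |w|, and so is every child of w; as
-- |w| = 1 + Σ|children of w| this gives λ ∣ 1, impossible.

open import Defs
open import Data.Nat
open import Data.Nat.Properties
open import Data.Nat.DivMod using (_%_; [m+kn]%n≡m%n; m<n⇒m%n≡m)
open import Data.Nat.Divisibility using (_∣_; _∣0; ∣m∣n⇒∣m+n; ∣m+n∣m⇒∣n; m∣m*n; ∣1⇒≡1; ∣⇒≤)
open import Data.Nat.ListAction using (sum)
open import Data.Nat.ListAction.Properties using (sum-++)
open import Data.Nat.Tactic.RingSolver using (solve-∀)
open import Data.Bool using (true; false; if_then_else_) renaming (T to True)
open import Data.List using (List; []; _∷_; map; length; _++_; filter)
open import Data.List.Properties using (map-++; map-cong; map-∘)
open import Data.List.Membership.Propositional using (_∈_)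
open import Data.List.Membership.Propositional.Properties using (∈-++⁺ˡ; ∈-++⁺ʳ; ∈-map⁺)
open import Data.List.Relation.Unary.Any using (here; there)
open import Data.Fin using (Fin; zero; suc)
open import Data.Product using (Σ; ∃; _×_; _,_; proj₁; proj₂)
open import Data.Sum using (_⊎_; inj₁; inj₂)
open import Data.Empty using (⊥; ⊥-elim)
open import Data.Unit using (tt)
open import Function using (_∘_)
open import Relation.Nullary using (yes; no)
open import Relation.Binary.PropositionalEquality

indicator-≢ : ∀ {x y} c → x ≢ y → (if x ≡ᵇ y then c else 0) ≡ 0
indicator-≢ {x} {y} c x≢y with x ≡ᵇ y in eq
... | true  = ⊥-elim (x≢y (≡ᵇ⇒≡ x y (subst True (sym eq) tt)))
... | false = refl

indicator-refl : ∀ x c → (if x ≡ᵇ x then c else 0) ≡ c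
indicator-refl x c with x ≡ᵇ x in eq
... | true  = refl
... | false = ⊥-elim (subst True eq (≡⇒≡ᵇ x x refl))

indicator-pos : ∀ {x y} c → 1 ≤ (if x ≡ᵇ y then c else 0) → x ≡ y
indicator-pos {x} {y} c pos with x ≡ᵇ y in eq
... | true  = ≡ᵇ⇒≡ x y (subst True (sym eq) tt)
indicator-pos c () | false

sumBelow : ℕ → (ℕ → ℕ) → ℕ
sumBelow zero    f = 0
sumBelow (suc M) f = sumBelow M f + f M

sumBelow-cong : ∀ M {f f′ : ℕ → ℕ} → (∀ ℓ → f ℓ ≡ f′ ℓ) → sumBelow M f ≡ sumBelow M f′
sumBelow-cong zero    f≗f′ = refl
sumBelow-cong (suc M) f≗f′ = cong₂ _+_ (sumBelow-cong M f≗f′) (f≗f′ M)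

sumBelow-+ : ∀ M (f f′ : ℕ → ℕ) → sumBelow M (λ ℓ → f ℓ + f′ ℓ) ≡ sumBelow M f + sumBelow M f′
sumBelow-+ zero    f f′ = refl
sumBelow-+ (suc M) f f′ rewrite sumBelow-+ M f f′ = middle-swap (sumBelow M f) (sumBelow M f′) (f M) (f′ M)
  where
  middle-swap : ∀ a b c d → (a + b) + (c + d) ≡ (a + c) + (b + d)
  middle-swap = solve-∀

sumBelow-vanish : ∀ M (f : ℕ → ℕ) → (∀ ℓ → ℓ < M → f ℓ ≡ 0) → sumBelow M f ≡ 0
sumBelow-vanish zero    f vanish = refl
sumBelow-vanish (suc M) f vanish =
  cong₂ _+_ (sumBelow-vanish M f (λ ℓ ℓ<M → vanish ℓ (m<n⇒m<1+n ℓ<M))) (vanish M ≤-refl)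

sumBelow-single : ∀ M (f : ℕ → ℕ) X → X < M → (∀ ℓ → ℓ ≢ X → f ℓ ≡ 0) → sumBelow M f ≡ f X
sumBelow-single zero    f X () off
sumBelow-single (suc M) f X X<1+M off with X ≟ M
... | yes refl = cong (_+ f X) (sumBelow-vanish M f (λ ℓ ℓ<M → off ℓ (λ ℓ≡M → <-irrefl ℓ≡M ℓ<M)))
... | no X≢M = begin
  sumBelow M f + f M ≡⟨ cong₂ _+_ (sumBelow-single M f X (≤∧≢⇒< (≤-pred X<1+M) X≢M) off) (off M (X≢M ∘ sym)) ⟩
  f X + 0            ≡⟨ +-identityʳ (f X) ⟩
  f X                ∎
  where open ≡-Reasoning

sumBelow-indicator : ∀ M (G : ℕ → ℕ) Z c → Z < M →
  sumBelow M (λ ℓ → G ℓ * (if ℓ ≡ᵇ Z then c else 0)) ≡ G Z * c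
sumBelow-indicator M G Z c Z<M =
  trans (sumBelow-single M _ Z Z<M (λ ℓ ℓ≢Z → trans (cong (G ℓ *_) (indicator-≢ c ℓ≢Z)) (*-zeroʳ (G ℓ))))
        (cong (G Z *_) (indicator-refl Z c))

ΣFin-cong : ∀ k {f f′ : Fin k → ℕ} → (∀ j → f j ≡ f′ j) → ΣFin k f ≡ ΣFin k f′
ΣFin-cong zero    f≗f′ = refl
ΣFin-cong (suc k) f≗f′ = cong₂ _+_ (f≗f′ zero) (ΣFin-cong k (f≗f′ ∘ suc))

ΣFin-const : ∀ k c → ΣFin k (λ _ → c) ≡ k * c
ΣFin-const zero    c = refl
ΣFin-const (suc k) c = cong (c +_) (ΣFin-const k c)

ΣFin-*ˡ : ∀ k x (f : Fin k → ℕ) → x * ΣFin k f ≡ ΣFin k (λ j → x * f j)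
ΣFin-*ˡ zero    x f = *-zeroʳ x
ΣFin-*ˡ (suc k) x f = trans (*-distribˡ-+ x (f zero) _) (cong (x * f zero +_) (ΣFin-*ˡ k x (f ∘ suc)))

+-pos : ∀ x {y} → 1 ≤ x + y → 1 ≤ x ⊎ 1 ≤ y
+-pos zero    pos = inj₂ pos
+-pos (suc x) _   = inj₁ (s≤s z≤n)

ΣFin-pos : ∀ k (f : Fin k → ℕ) → 1 ≤ ΣFin k f → Σ (Fin k) (λ j → 1 ≤ f j)
ΣFin-pos zero    f ()
ΣFin-pos (suc k) f pos with f zero in eq
... | suc _ = zero , subst (1 ≤_) (sym eq) (s≤s z≤n)
... | zero with ΣFin-pos k (f ∘ suc) pos
...   | j , fj≥1 = suc j , fj≥1

sumBelow-ΣFin : ∀ M k (f : ℕ → Fin k → ℕ) →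
  sumBelow M (λ ℓ → ΣFin k (f ℓ)) ≡ ΣFin k (λ j → sumBelow M (λ ℓ → f ℓ j))
sumBelow-ΣFin M zero    f = sumBelow-vanish M _ (λ _ _ → refl)
sumBelow-ΣFin M (suc k) f =
  trans (sumBelow-+ M (λ ℓ → f ℓ zero) (λ ℓ → ΣFin k (f ℓ ∘ suc)))
        (cong (sumBelow M (λ ℓ → f ℓ zero) +_) (sumBelow-ΣFin M k (λ ℓ → f ℓ ∘ suc)))

count : {A : Set} → (A → ℕ) → List A → ℕ → ℕ
count lab xs ℓ = length (filter (λ x → lab x ≟ ℓ) xs)

count-∷ : ∀ {A : Set} (lab : A → ℕ) x xs ℓ →
  count lab (x ∷ xs) ℓ ≡ (if lab x ≡ᵇ ℓ then 1 else 0) + count lab xs ℓ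
count-∷ lab x xs ℓ with lab x ≡ᵇ ℓ
... | true  = refl
... | false = refl

count-member : ∀ {A : Set} (lab : A → ℕ) xs {x} → x ∈ xs → 1 ≤ count lab xs (lab x)
count-member lab (y ∷ xs) {x} x∈ rewrite count-∷ lab y xs (lab x) with x∈
... | here refl = ≤-trans (≤-reflexive (sym (indicator-refl (lab y) 1))) (m≤m+n _ _)
... | there x∈xs = ≤-trans (count-member lab xs x∈xs) (m≤n+m _ _)

sumBelow-count : ∀ {A : Set} (lab : A → ℕ) (G : ℕ → ℕ) M xs → (∀ {x} → x ∈ xs → lab x < M) →
  sumBelow M (λ ℓ → G ℓ * count lab xs ℓ) ≡ sum (map (G ∘ lab) xs)
sumBelow-count lab G M [] bound = sumBelow-vanish M _ (λ ℓ _ → *-zeroʳ (G ℓ))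
sumBelow-count lab G M (x ∷ xs) bound = begin
  sumBelow M (λ ℓ → G ℓ * count lab (x ∷ xs) ℓ)
    ≡⟨ sumBelow-cong M split ⟩
  sumBelow M (λ ℓ → G ℓ * ind ℓ + G ℓ * count lab xs ℓ)
    ≡⟨ sumBelow-+ M _ _ ⟩
  sumBelow M (λ ℓ → G ℓ * ind ℓ) + sumBelow M (λ ℓ → G ℓ * count lab xs ℓ)
    ≡⟨ cong₂ _+_ own-label (sumBelow-count lab G M xs (bound ∘ there)) ⟩
  G (lab x) + sum (map (G ∘ lab) xs) ∎
  where
  open ≡-Reasoning
  ind : ℕ → ℕ
  ind ℓ = if lab x ≡ᵇ ℓ then 1 else 0
  split : ∀ ℓ → G ℓ * count lab (x ∷ xs) ℓ ≡ G ℓ * ind ℓ + G ℓ * count lab xs ℓ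
  split ℓ = trans (cong (G ℓ *_) (count-∷ lab x xs ℓ)) (*-distribˡ-+ (G ℓ) (ind ℓ) _)
  own-label : sumBelow M (λ ℓ → G ℓ * ind ℓ) ≡ G (lab x)
  own-label = trans (sumBelow-single M _ (lab x) (bound (here refl))
                  (λ ℓ ℓ≢ → trans (cong (G ℓ *_) (indicator-≢ 1 (ℓ≢ ∘ sym))) (*-zeroʳ (G ℓ))))
               (trans (cong (G (lab x) *_) (indicator-refl (lab x) 1)) (*-identityʳ _))

sum-map-mono : ∀ {A : Set} (f F : A → ℕ) xs → (∀ {x} → x ∈ xs → f x ≤ F x) →
  sum (map f xs) ≤ sum (map F xs)
sum-map-mono f F []       f≤F = z≤n
sum-map-mono f F (x ∷ xs) f≤F = +-mono-≤ (f≤F (here refl)) (sum-map-mono f F xs (f≤F ∘ there))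

sum-map-surplus : ∀ {A : Set} (f F : A → ℕ) xs → (∀ {x} → x ∈ xs → f x ≤ F x) →
  ∀ {x e} → x ∈ xs → f x + e ≤ F x → sum (map f xs) + e ≤ sum (map F xs)
sum-map-surplus f F (y ∷ ys) f≤F {e = e} (here refl) surplus = begin
  f y + sum (map f ys) + e   ≡⟨ +-assoc (f y) _ e ⟩
  f y + (sum (map f ys) + e) ≡⟨ cong (f y +_) (+-comm _ e) ⟩
  f y + (e + sum (map f ys)) ≡⟨ +-assoc (f y) e _ ⟨
  f y + e + sum (map f ys)   ≤⟨ +-mono-≤ surplus (sum-map-mono f F ys (f≤F ∘ there)) ⟩
  F y + sum (map F ys)       ∎
  where open ≤-Reasoning
sum-map-surplus f F (y ∷ ys) f≤F {e = e} (there x∈ys) surplus = begin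
  f y + sum (map f ys) + e   ≡⟨ +-assoc (f y) _ e ⟩
  f y + (sum (map f ys) + e) ≤⟨ +-mono-≤ (f≤F (here refl)) (sum-map-surplus f F ys (f≤F ∘ there) x∈ys surplus) ⟩
  F y + sum (map F ys)       ∎
  where open ≤-Reasoning

no-surplus : ∀ {A : Set} (f F : A → ℕ) xs → (∀ {x} → x ∈ xs → f x ≤ F x) →
  sum (map F xs) ≤ sum (map f xs) → ∀ {x e} → x ∈ xs → f x + e ≤ F x → e ≡ 0
no-surplus f F xs f≤F F≤f x∈xs surplus =
  n≤0⇒n≡0 (+-cancelˡ-≤ (sum (map f xs)) _ 0
    (≤-trans (sum-map-surplus f F xs f≤F x∈xs surplus) (≤-trans F≤f (≤-reflexive (sym (+-identityʳ _))))))

three-parts : ∀ {A : Set} (f : A → ℕ) c xs → 1 ≤ c →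
  (∀ {x} → x ∈ xs → c < 4 * f x) → (∀ {x} → x ∈ xs → 2 * f x < c) →
  sum (map f xs) ≡ c → length xs ≡ 3
three-parts f c [] c≥1 big small refl = ⊥-elim (<-irrefl refl c≥1)
three-parts f c (x ∷ []) c≥1 big small refl =
  ⊥-elim (<⇒≱ (small (here refl)) (+-monoʳ-≤ (f x) z≤n))
three-parts f c (x ∷ y ∷ []) c≥1 big small refl = ⊥-elim (<-irrefl (twice (f x) (f y)) (begin-strict
  2 * f x + 2 * f y         <⟨ +-mono-< (small (here refl)) (small (there (here refl))) ⟩
  c + c                     ∎))
  where
  open ≤-Reasoning
  twice : ∀ a b → 2 * a + 2 * b ≡ (a + (b + 0)) + (a + (b + 0))
  twice = solve-∀
three-parts f c (x ∷ y ∷ z ∷ []) c≥1 big small sum≡c = refl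
three-parts f c (x ∷ y ∷ z ∷ w ∷ rest) c≥1 big small refl = ⊥-elim (<-irrefl refl (begin-strict
  4 * c                                   ≡⟨ four c ⟩
  c + c + c + c                           <⟨ +-mono-< (+-mono-< (+-mono-< (big (here refl)) (big (there (here refl))))
                                                       (big (there (there (here refl))))) (big (there (there (there (here refl))))) ⟩
  4 * f x + 4 * f y + 4 * f z + 4 * f w   ≡⟨ collect (f x) (f y) (f z) (f w) ⟩
  4 * (f x + (f y + (f z + f w)))         ≤⟨ *-monoʳ-≤ 4 (≤-trans (m≤m+n _ (sum (map f rest))) (≤-reflexive (regroup (f x) (f y) (f z) (f w) _))) ⟩
  4 * c                                   ∎))
  where
  open ≤-Reasoning
  four : ∀ a → 4 * a ≡ a + a + a + a
  four = solve-∀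
  collect : ∀ a b d e → 4 * a + 4 * b + 4 * d + 4 * e ≡ 4 * (a + (b + (d + e)))
  collect = solve-∀
  regroup : ∀ a b d e r → (a + (b + (d + e))) + r ≡ a + (b + (d + (e + r)))
  regroup = solve-∀

sum-map-scale : ∀ {A : Set} k (f : A → ℕ) xs → sum (map (λ x → k * f x) xs) ≡ k * sum (map f xs)
sum-map-scale k f []       = sym (*-zeroʳ k)
sum-map-scale k f (x ∷ xs) = trans (cong (k * f x +_) (sum-map-scale k f xs)) (sym (*-distribˡ-+ k (f x) _))

∣-sum-map : ∀ {A : Set} d (f : A → ℕ) xs → (∀ {x} → x ∈ xs → d ∣ f x) → d ∣ sum (map f xs)
∣-sum-map d f []       d∣f = d ∣0
∣-sum-map d f (x ∷ xs) d∣f = ∣m∣n⇒∣m+n (d∣f (here refl)) (∣-sum-map d f xs (d∣f ∘ there))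

mutual
  allPos-complete : ∀ {t} (p : Pos t) → p ∈ allPos t
  allPos-complete root        = here refl
  allPos-complete (child m p) = there (allPosL-complete _ child m p)

  allPosL-complete : ∀ {B : Set} ts (f : ∀ {t} → t ∈ ts → Pos t → B) {t} (m : t ∈ ts) (p : Pos t) →
    f m p ∈ allPosL ts f
  allPosL-complete (t ∷ ts) f (here refl) p = ∈-++⁺ˡ (∈-map⁺ (f (here refl)) (allPos-complete p))
  allPosL-complete (t ∷ ts) f (there m) p =
    ∈-++⁺ʳ (map (f (here refl)) (allPos t)) (allPosL-complete ts (f ∘ there) m p)

labelFrom-≥ : ∀ μ {t} (p : Pos t) → μ ≤ labelFrom μ p
labelFrom-≥ μ root = ≤-refl
labelFrom-≥ μ {node ts} (child {t = t} m p) = ≤-trans (m≤m+n μ (size t)) (labelFrom-≥ (μ + size t) p)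

labelFrom-> : ∀ μ {t} (p : Pos t) → NonRoot p → μ < labelFrom μ p
labelFrom-> μ {node ts} (child {t = node us} m p) _ =
  <-≤-trans (m<m+n μ (s≤s z≤n)) (labelFrom-≥ (μ + size (node us)) p)

extend : ∀ {t} (p : Pos t) {u} → u ∈ children (subtree p) → Pos t
extend {node ts} root {node us} u∈ = child u∈ root
extend (child m p) u∈ = child m (extend p u∈)

extend-label : ∀ μ {t} (p : Pos t) {u} (u∈ : u ∈ children (subtree p)) →
  labelFrom μ (extend p u∈) ≡ labelFrom μ p + size u
extend-label μ {node ts} root {node us} u∈ = refl
extend-label μ {node ts} (child {t = t} m p) u∈ = extend-label (μ + size t) p u∈

extend-subtree : ∀ {t} (p : Pos t) {u} (u∈ : u ∈ children (subtree p)) → subtree (extend p u∈) ≡ u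
extend-subtree {node ts} root {node us} u∈ = refl
extend-subtree (child m p) u∈ = extend-subtree p u∈

extend-nonroot : ∀ {t} (p : Pos t) {u} (u∈ : u ∈ children (subtree p)) → NonRoot (extend p u∈)
extend-nonroot {node ts} root {node us} u∈ = tt
extend-nonroot (child m p) u∈ = tt

sizes-sum : ∀ ts → sizes ts ≡ sum (map size ts)
sizes-sum []       = refl
sizes-sum (t ∷ ts) = cong (size t +_) (sizes-sum ts)

module LabelWeight (g : ℕ → ℕ) where
  mutual
    weight : ℕ → Tree → ℕ
    weight μ (node ts) = g μ + weights μ ts

    weights : ℕ → List Tree → ℕ
    weights μ []       = 0
    weights μ (t ∷ ts) = weight (μ + size t) t + weights μ ts

  weights-sum : ∀ μ ts → weights μ ts ≡ sum (map (λ t → weight (μ + size t) t) ts)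
  weights-sum μ []       = refl
  weights-sum μ (t ∷ ts) = cong (weight (μ + size t) t +_) (weights-sum μ ts)

  mutual
    weight-allPos : ∀ μ t → sum (map (g ∘ labelFrom μ) (allPos t)) ≡ weight μ t
    weight-allPos μ (node ts) = cong (g μ +_) (weights-allPosL μ ts child (g ∘ labelFrom μ) (λ _ _ → refl))

    weights-allPosL : ∀ {B : Set} μ ts (f : ∀ {t} → t ∈ ts → Pos t → B) (H : B → ℕ) →
      (∀ {t} (m : t ∈ ts) p → H (f m p) ≡ g (labelFrom (μ + size t) p)) →
      sum (map H (allPosL ts f)) ≡ weights μ ts
    weights-allPosL μ [] f H H-f = refl
    weights-allPosL μ (t ∷ ts) f H H-f = begin
      sum (map H (map (f (here refl)) (allPos t) ++ allPosL ts (f ∘ there)))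
        ≡⟨ cong sum (map-++ H (map (f (here refl)) (allPos t)) _) ⟩
      sum (map H (map (f (here refl)) (allPos t)) ++ map H (allPosL ts (f ∘ there)))
        ≡⟨ sum-++ (map H (map (f (here refl)) (allPos t))) _ ⟩
      sum (map H (map (f (here refl)) (allPos t))) + sum (map H (allPosL ts (f ∘ there)))
        ≡⟨ cong₂ _+_ first (weights-allPosL μ ts (f ∘ there) H (H-f ∘ there)) ⟩
      weight (μ + size t) t + weights μ ts ∎
      where
      open ≡-Reasoning
      first : sum (map H (map (f (here refl)) (allPos t))) ≡ weight (μ + size t) t
      first = trans (cong sum (sym (map-∘ (allPos t))))
                (trans (cong sum (map-cong (H-f (here refl)) (allPos t))) (weight-allPos (μ + size t) t))

  mutual
    weight-vertex : ∀ μ {t} (p : Pos t) → g (labelFrom μ p) ≤ weight μ t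
    weight-vertex μ {node ts} root        = m≤m+n (g μ) _
    weight-vertex μ {node ts} (child m p) = ≤-trans (weights-vertex μ ts m p) (m≤n+m _ (g μ))

    weights-vertex : ∀ μ ts {t} (m : t ∈ ts) (p : Pos t) → g (labelFrom (μ + size t) p) ≤ weights μ ts
    weights-vertex μ (t ∷ ts) (here refl) p = ≤-trans (weight-vertex (μ + size t) p) (m≤m+n _ _)
    weights-vertex μ (t ∷ ts) (there m) p   = ≤-trans (weights-vertex μ ts m p) (m≤n+m _ _)

  weight-root-vertex : ∀ μ {t} (p : Pos t) → NonRoot p → g μ + g (labelFrom μ p) ≤ weight μ t
  weight-root-vertex μ {node ts} (child m p) _ = +-monoʳ-≤ (g μ) (weights-vertex μ ts m p)

  topLayers : ℕ → List Tree → ℕ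
  topLayers μ us = g μ + sum (map (λ u → g (μ + size u)) us)

  children-bound : ∀ μ us {u} → u ∈ us → g (μ + size u) ≤ weight (μ + size u) u
  children-bound μ us {node zs} _ = weight-vertex _ {node zs} root

  weight-top : ∀ μ us → topLayers μ us ≤ weight μ (node us)
  weight-top μ us = +-monoʳ-≤ (g μ) (≤-trans (sum-map-mono _ _ us (children-bound μ us))
                                              (≤-reflexive (sym (weights-sum μ us))))

  weight-top-deep : ∀ μ us {u} (u∈ : u ∈ us) (p : Pos u) → NonRoot p →
    topLayers μ us + g (labelFrom (μ + size u) p) ≤ weight μ (node us)
  weight-top-deep μ us {u} u∈ p nr = begin
    g μ + sum (map (λ u → g (μ + size u)) us) + g (labelFrom (μ + size u) p)
      ≡⟨ +-assoc (g μ) _ _ ⟩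
    g μ + (sum (map (λ u → g (μ + size u)) us) + g (labelFrom (μ + size u) p))
      ≤⟨ +-monoʳ-≤ (g μ) (sum-map-surplus _ _ us (children-bound μ us) u∈ (weight-root-vertex _ p nr)) ⟩
    g μ + sum (map (λ t → weight (μ + size t) t) us)
      ≡⟨ cong (g μ +_) (weights-sum μ us) ⟨
    weight μ (node us) ∎
    where open ≤-Reasoning

  mutual
    weight-zero : ∀ ν t → (∀ ℓ → ν ≤ ℓ → g ℓ ≡ 0) → weight ν t ≡ 0
    weight-zero ν (node ts) vanish = cong₂ _+_ (vanish ν ≤-refl) (weights-zero ν ts (λ ℓ → vanish ℓ ∘ <⇒≤))

    weights-zero : ∀ μ ts → (∀ ℓ → μ < ℓ → g ℓ ≡ 0) → weights μ ts ≡ 0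
    weights-zero μ [] vanish = refl
    weights-zero μ (node us ∷ ts) vanish =
      cong₂ _+_ (weight-zero (μ + size (node us)) (node us) (λ ℓ → vanish ℓ ∘ <-≤-trans (m<m+n μ (s≤s z≤n))))
                (weights-zero μ ts vanish)

  weight-vanish : ∀ μ t → (∀ ℓ → μ < ℓ → g ℓ ≡ 0) → weight μ t ≡ g μ
  weight-vanish μ (node ts) vanish = trans (cong (g μ +_) (weights-zero μ ts vanish)) (+-identityʳ (g μ))

open LabelWeight using (weight; weights; weights-sum; weight-allPos; weight-vertex; topLayers; weight-top; weight-top-deep; weight-vanish)

module Avalanche (n C : ℕ) (a : Fin (3 * n) → ℕ) (lam : ℕ)
                 (n≥1 : 1 ≤ n) (a-lower : ∀ i → C < 4 * a i) (a-upper : ∀ i → 2 * a i < C)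
                 (lam>3n : 3 * n < lam)
                 (ts : List Tree) (coeff : ∀ i → 1 ≤ i → avCoeff (node ts) i ≡ PCoeff n C a lam i) where

  T : Tree
  T = node ts

  m : ℕ
  m = lam * C + 1

  X Y : Fin (3 * n) → ℕ
  X j = lam * C + 1 + lam * a j
  Y j = lam * C + lam * a j + 2

  data Allowed (ℓ : ℕ) : Set where
    is-m : ℓ ≡ m → Allowed ℓ
    is-X : ∀ j → ℓ ≡ X j → Allowed ℓ
    is-Y : ∀ j → ℓ ≡ Y j → Allowed ℓ

  lam≥4 : 4 ≤ lam
  lam≥4 = ≤-trans (s≤s (*-monoʳ-≤ 3 n≥1)) lam>3n

  instance
    lam-nonZero : NonZero lam
    lam-nonZero = >-nonZero (≤-trans (s≤s z≤n) lam≥4)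

  some-j : Fin (3 * n)
  some-j = first n n≥1
    where
    first : ∀ k → 1 ≤ k → Fin (3 * k)
    first (suc k) _ = zero

  a≥1 : ∀ j → 1 ≤ a j
  a≥1 j with a j | a-lower j
  ... | suc _ | _ = s≤s z≤n

  a≤C : ∀ j → a j ≤ C
  a≤C j = ≤-trans (m≤m+n (a j) (a j + 0)) (<⇒≤ (a-upper j))

  m<X : ∀ j → m < X j
  m<X j = ≤-trans (≤-reflexive (+-comm 1 m)) (+-monoʳ-≤ m (*-mono-≤ (≤-trans (s≤s z≤n) lam≥4) (a≥1 j)))

  X<Y : ∀ j → X j < Y j
  X<Y j = ≤-reflexive (next (lam * C) (lam * a j))
    where
    next : ∀ x y → suc (x + 1 + y) ≡ x + y + 2
    next = solve-∀

  m<Y : ∀ j → m < Y j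
  m<Y j = <-trans (m<X j) (X<Y j)

  bound : ℕ
  bound = suc (lam * C + lam * C + 2)

  Y<bound : ∀ j → Y j < bound
  Y<bound j = s≤s (+-monoˡ-≤ 2 (+-monoʳ-≤ (lam * C) (*-monoʳ-≤ lam (a≤C j))))

  allowed-≥ : ∀ {ℓ} → Allowed ℓ → m ≤ ℓ
  allowed-≥ (is-m refl)   = ≤-refl
  allowed-≥ (is-X j refl) = <⇒≤ (m<X j)
  allowed-≥ (is-Y j refl) = <⇒≤ (m<Y j)

  allowed-< : ∀ {ℓ} → Allowed ℓ → ℓ < bound
  allowed-< (is-m refl)   = <-trans (m<Y some-j) (Y<bound some-j)
  allowed-< (is-X j refl) = <-trans (X<Y j) (Y<bound j)
  allowed-< (is-Y j refl) = Y<bound j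

  PCoeff-support : ∀ ℓ → 1 ≤ PCoeff n C a lam ℓ → Allowed ℓ
  PCoeff-support ℓ pos with +-pos _ pos
  ... | inj₂ posY with ΣFin-pos _ _ posY
  ...   | j , p = is-Y j (indicator-pos _ p)
  PCoeff-support ℓ pos | inj₁ posmX with +-pos _ posmX
  ... | inj₁ posm = is-m (indicator-pos n posm)
  ... | inj₂ posX with ΣFin-pos _ _ posX
  ...   | j , p = is-X j (indicator-pos 1 p)

  label-allowed : (p : Pos T) → NonRoot p → Allowed (label p)
  label-allowed p nr = PCoeff-support (label p)
    (subst (1 ≤_) (coeff (label p) (labelFrom-> 0 p nr)) (count-member label (allPos T) (allPos-complete p)))

  label-< : (p : Pos T) → label p < bound
  label-< root            = s≤s z≤n
  label-< p@(child _ _)   = allowed-< (label-allowed p tt)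

  PCoeff-weighted : ∀ (G : ℕ → ℕ) → sumBelow bound (λ ℓ → G ℓ * PCoeff n C a lam ℓ)
    ≡ G m * n + ΣFin (3 * n) (λ j → G (X j)) + ΣFin (3 * n) (λ j → G (Y j) * (lam * a j ∸ 1))
  PCoeff-weighted G = begin
    sumBelow bound (λ ℓ → G ℓ * PCoeff n C a lam ℓ)
      ≡⟨ sumBelow-cong bound distribute ⟩
    sumBelow bound (λ ℓ → termm ℓ + ΣFin (3 * n) (termX ℓ) + ΣFin (3 * n) (termY ℓ))
      ≡⟨ trans (sumBelow-+ bound _ _) (cong (_+ sumBelow bound (λ ℓ → ΣFin (3 * n) (termY ℓ))) (sumBelow-+ bound _ _)) ⟩
    sumBelow bound termm + sumBelow bound (λ ℓ → ΣFin (3 * n) (termX ℓ))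
      + sumBelow bound (λ ℓ → ΣFin (3 * n) (termY ℓ))
      ≡⟨ cong₂ _+_ (cong₂ _+_ (sumBelow-indicator bound G m n (allowed-< (is-m refl)))
                              (trans (sumBelow-ΣFin bound (3 * n) termX) (ΣFin-cong (3 * n) selectX)))
                   (trans (sumBelow-ΣFin bound (3 * n) termY) (ΣFin-cong (3 * n) selectY)) ⟩
    G m * n + ΣFin (3 * n) (λ j → G (X j)) + ΣFin (3 * n) (λ j → G (Y j) * (lam * a j ∸ 1)) ∎
    where
    open ≡-Reasoning
    termm : ℕ → ℕ
    termm ℓ = G ℓ * (if ℓ ≡ᵇ m then n else 0)
    termX termY : ℕ → Fin (3 * n) → ℕ
    termX ℓ j = G ℓ * (if ℓ ≡ᵇ X j then 1 else 0)
    termY ℓ j = G ℓ * (if ℓ ≡ᵇ Y j then lam * a j ∸ 1 else 0)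
    distribute : ∀ ℓ → G ℓ * PCoeff n C a lam ℓ ≡ termm ℓ + ΣFin (3 * n) (termX ℓ) + ΣFin (3 * n) (termY ℓ)
    distribute ℓ = trans (*-distribˡ-+ (G ℓ) _ _)
      (cong₂ _+_ (trans (*-distribˡ-+ (G ℓ) _ _) (cong (termm ℓ +_) (ΣFin-*ˡ (3 * n) (G ℓ) _)))
                 (ΣFin-*ˡ (3 * n) (G ℓ) _))
    selectX : ∀ j → sumBelow bound (λ ℓ → termX ℓ j) ≡ G (X j)
    selectX j = trans (sumBelow-indicator bound G (X j) 1 (allowed-< (is-X j refl))) (*-identityʳ _)
    selectY : ∀ j → sumBelow bound (λ ℓ → termY ℓ j) ≡ G (Y j) * (lam * a j ∸ 1)
    selectY j = sumBelow-indicator bound G (Y j) _ (allowed-< (is-Y j refl))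

  total-weight : ∀ (G : ℕ → ℕ) → G 0 ≡ 0 → weight G 0 T
    ≡ G m * n + ΣFin (3 * n) (λ j → G (X j)) + ΣFin (3 * n) (λ j → G (Y j) * (lam * a j ∸ 1))
  total-weight G G0≡0 = begin
    weight G 0 T
      ≡⟨ weight-allPos G 0 T ⟨
    sum (map (G ∘ label) (allPos T))
      ≡⟨ sumBelow-count label G bound (allPos T) (λ {p} _ → label-< p) ⟨
    sumBelow bound (λ ℓ → G ℓ * avCoeff T ℓ)
      ≡⟨ sumBelow-cong bound by-coeff ⟩
    sumBelow bound (λ ℓ → G ℓ * PCoeff n C a lam ℓ)
      ≡⟨ PCoeff-weighted G ⟩
    G m * n + ΣFin (3 * n) (λ j → G (X j)) + ΣFin (3 * n) (λ j → G (Y j) * (lam * a j ∸ 1)) ∎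
    where
    open ≡-Reasoning
    by-coeff : ∀ ℓ → G ℓ * avCoeff T ℓ ≡ G ℓ * PCoeff n C a lam ℓ
    by-coeff zero    rewrite G0≡0 = refl
    by-coeff (suc ℓ) = cong (G (suc ℓ) *_) (coeff (suc ℓ) (s≤s z≤n))

  g : ℕ → ℕ
  g ℓ = if ℓ % lam ≡ᵇ 1 then 1 else 0

  g-residue : ∀ r k → r < lam → g (r + k * lam) ≡ (if r ≡ᵇ 1 then 1 else 0)
  g-residue r k r<lam = cong (λ x → if x ≡ᵇ 1 then 1 else 0) (trans ([m+kn]%n≡m%n r k lam) (m<n⇒m%n≡m r<lam))

  g-0 : g 0 ≡ 0
  g-0 = g-residue 0 0 (≤-trans (s≤s z≤n) lam≥4)

  g-m : g m ≡ 1
  g-m = trans (cong g (trans (+-comm _ 1) (cong (1 +_) (*-comm lam C)))) (g-residue 1 C (≤-trans (s≤s (s≤s z≤n)) lam≥4))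

  g-X : ∀ j → g (X j) ≡ 1
  g-X j = trans (cong g (residue lam C (a j))) (g-residue 1 (C + a j) (≤-trans (s≤s (s≤s z≤n)) lam≥4))
    where
    residue : ∀ l c b → l * c + 1 + l * b ≡ 1 + (c + b) * l
    residue = solve-∀

  g-Y : ∀ j → g (Y j) ≡ 0
  g-Y j = trans (cong g (residue lam C (a j))) (g-residue 2 (C + a j) (≤-trans (s≤s (s≤s (s≤s z≤n))) lam≥4))
    where
    residue : ∀ l c b → l * c + l * b + 2 ≡ 2 + (c + b) * l
    residue = solve-∀

  h : ℕ → ℕ
  h ℓ = if ℓ ≡ᵇ m then 1 else 0

  h-off : ∀ ℓ → ℓ ≢ m → h ℓ ≡ 0
  h-off ℓ = indicator-≢ 1

  h-m : h m ≡ 1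
  h-m = indicator-refl m 1

  h-0 : h 0 ≡ 0
  h-0 = h-off 0 (λ 0≡m → 0≢1+n (trans 0≡m (+-comm (lam * C) 1)))

  g-total : weight g 0 T ≡ 4 * n
  g-total = begin
    weight g 0 T
      ≡⟨ total-weight g g-0 ⟩
    g m * n + ΣFin (3 * n) (λ j → g (X j)) + ΣFin (3 * n) (λ j → g (Y j) * (lam * a j ∸ 1))
      ≡⟨ cong₂ _+_ (cong₂ _+_ (cong (_* n) g-m) (trans (ΣFin-cong (3 * n) g-X) (ΣFin-const (3 * n) 1)))
                   (trans (ΣFin-cong (3 * n) (λ j → cong (_* _) (g-Y j))) (ΣFin-const (3 * n) 0)) ⟩
    1 * n + 3 * n * 1 + 3 * n * 0
      ≡⟨ count-up n ⟩
    4 * n ∎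
    where
    open ≡-Reasoning
    count-up : ∀ k → 1 * k + 3 * k * 1 + 3 * k * 0 ≡ 4 * k
    count-up = solve-∀

  h-total : weight h 0 T ≡ n
  h-total = begin
    weight h 0 T
      ≡⟨ total-weight h h-0 ⟩
    h m * n + ΣFin (3 * n) (λ j → h (X j)) + ΣFin (3 * n) (λ j → h (Y j) * (lam * a j ∸ 1))
      ≡⟨ cong₂ _+_ (cong₂ _+_ (cong (_* n) h-m) (trans (ΣFin-cong (3 * n) (λ j → h-off _ (>⇒≢ (m<X j)))) (ΣFin-const (3 * n) 0)))
                   (trans (ΣFin-cong (3 * n) (λ j → cong (_* _) (h-off _ (>⇒≢ (m<Y j))))) (ΣFin-const (3 * n) 0)) ⟩
    1 * n + 3 * n * 0 + 3 * n * 0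
      ≡⟨ count-up n ⟩
    n ∎
    where
    open ≡-Reasoning
    count-up : ∀ k → 1 * k + 3 * k * 0 + 3 * k * 0 ≡ k
    count-up = solve-∀

  -- A root child is labelled by its size, so its size is at least m, and no
  -- vertex strictly below it is labelled m.
  root-child-≥ : ∀ {t} → t ∈ ts → m ≤ size t
  root-child-≥ {node us} t∈ = allowed-≥ (label-allowed (child t∈ root) tt)

  root-child-h : ∀ {t} → t ∈ ts → weight h (size t) t ≡ h (size t)
  root-child-h {t} t∈ = weight-vanish h (size t) t
    (λ ℓ size<ℓ → h-off ℓ (λ ℓ≡m → <-irrefl (sym ℓ≡m) (≤-<-trans (root-child-≥ t∈) size<ℓ)))

  Part : ℕ → Set
  Part s = Σ (Fin (3 * n)) (λ j → Σ ℕ (λ e → (e ≤ 1) × (s ≡ lam * a j + e)))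

  part-of-allowed : ∀ s → 1 ≤ s → Allowed (m + s) → Part s
  part-of-allowed (suc s) _ (is-m m+s≡m) = ⊥-elim (m+1+n≢m m m+s≡m)
  part-of-allowed s _ (is-X j m+s≡X) = j , 0 , z≤n , trans (+-cancelˡ-≡ m s _ m+s≡X) (sym (+-identityʳ _))
  part-of-allowed s _ (is-Y j m+s≡Y) = j , 1 , ≤-refl , +-cancelˡ-≡ m s _ (trans m+s≡Y (shift lam C (a j)))
    where
    shift : ∀ l c b → l * c + l * b + 2 ≡ l * c + 1 + (l * b + 1)
    shift = solve-∀

  part-lower : ∀ {s} → Part s → lam * C < 4 * s
  part-lower (j , e , e≤1 , refl) = begin-strict
    lam * C            <⟨ m<m+n (lam * C) (≤-trans (s≤s z≤n) lam≥4) ⟩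
    lam * C + lam      ≡⟨ +-comm (lam * C) lam ⟩
    lam + lam * C      ≡⟨ *-suc lam C ⟨
    lam * suc C        ≤⟨ *-monoʳ-≤ lam (a-lower j) ⟩
    lam * (4 * a j)    ≡⟨ swap lam (a j) ⟩
    4 * (lam * a j)    ≤⟨ *-monoʳ-≤ 4 (m≤m+n (lam * a j) e) ⟩
    4 * (lam * a j + e) ∎
    where
    open ≤-Reasoning
    swap : ∀ l b → l * (4 * b) ≡ 4 * (l * b)
    swap = solve-∀

  part-upper : ∀ {s} → Part s → 2 * s < lam * C
  part-upper (j , e , e≤1 , refl) = begin-strict
    2 * (lam * a j + e)    ≤⟨ *-monoʳ-≤ 2 (+-monoʳ-≤ (lam * a j) e≤1) ⟩
    2 * (lam * a j + 1)    ≡⟨ expand lam (a j) ⟩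
    lam * (2 * a j) + 2    <⟨ +-monoʳ-< (lam * (2 * a j)) (≤-trans (s≤s (s≤s (s≤s z≤n))) lam≥4) ⟩
    lam * (2 * a j) + lam  ≡⟨ +-comm _ lam ⟩
    lam + lam * (2 * a j)  ≡⟨ *-suc lam (2 * a j) ⟨
    lam * suc (2 * a j)    ≤⟨ *-monoʳ-≤ lam (a-upper j) ⟩
    lam * C                ∎
    where
    open ≤-Reasoning
    expand : ∀ l b → 2 * (l * b + 1) ≡ l * (2 * b) + 2
    expand = solve-∀

  heavy-part : ∀ {us} → node us ∈ ts → size (node us) ≡ m → ∀ {u} → u ∈ us → Part (size u)
  heavy-part {us} t∈ size≡m {node zs} u∈ = part-of-allowed (size (node zs)) (s≤s z≤n)
    (subst (λ μ → Allowed (μ + size (node zs))) size≡m (label-allowed (child t∈ (child u∈ root)) tt))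

  heavy-sum : ∀ us → size (node us) ≡ m → sum (map size us) ≡ lam * C
  heavy-sum us size≡m = trans (sym (sizes-sum us)) (suc-injective (trans size≡m (+-comm (lam * C) 1)))

  small-multiple : ∀ E → lam ∣ E → E < lam → E ≡ 0
  small-multiple zero    _   _     = refl
  small-multiple (suc E) lam∣ E<lam = ⊥-elim (<⇒≱ E<lam (∣⇒≤ lam∣))

  -- Three parts summing to λC have no +1 excess (it would be a nonzero
  -- multiple of λ below λ), so each child is labelled by some X j.
  parts-exact : ∀ {s₁ s₂ s₃} → Part s₁ → Part s₂ → Part s₃ → s₁ + (s₂ + (s₃ + 0)) ≡ lam * C →
    g (m + s₁) + (g (m + s₂) + (g (m + s₃) + 0)) ≡ 3
  parts-exact (j₁ , e₁ , e₁≤1 , refl) (j₂ , e₂ , e₂≤1 , refl) (j₃ , e₃ , e₃≤1 , refl) total =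
    cong₂ _+_ (at-X j₁ e₁≡0) (cong₂ _+_ (at-X j₂ e₂≡0) (cong (_+ 0) (at-X j₃ e₃≡0)))
    where
    regroup : ∀ l x y z p q r → l * x + p + (l * y + q + (l * z + r + 0)) ≡ l * (x + y + z) + (p + q + r)
    regroup = solve-∀
    excess∣ : lam ∣ e₁ + e₂ + e₃
    excess∣ = ∣m+n∣m⇒∣n (subst (lam ∣_) (trans (sym total) (regroup lam (a j₁) (a j₂) (a j₃) e₁ e₂ e₃)) (m∣m*n C))
                        (m∣m*n _)
    excess≡0 : e₁ + e₂ + e₃ ≡ 0
    excess≡0 = small-multiple _ excess∣ (≤-trans (s≤s (+-mono-≤ (+-mono-≤ e₁≤1 e₂≤1) e₃≤1)) lam≥4)
    e₁≡0 : e₁ ≡ 0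
    e₁≡0 = m+n≡0⇒m≡0 e₁ (m+n≡0⇒m≡0 (e₁ + e₂) excess≡0)
    e₂≡0 : e₂ ≡ 0
    e₂≡0 = m+n≡0⇒n≡0 e₁ (m+n≡0⇒m≡0 (e₁ + e₂) excess≡0)
    e₃≡0 : e₃ ≡ 0
    e₃≡0 = m+n≡0⇒n≡0 (e₁ + e₂) excess≡0
    at-X : ∀ j {e} → e ≡ 0 → g (m + (lam * a j + e)) ≡ 1
    at-X j refl = trans (cong (λ x → g (m + x)) (+-identityʳ _)) (g-X j)

  three-layer : ∀ us → length us ≡ 3 → (∀ {u} → u ∈ us → Part (size u)) → sum (map size us) ≡ lam * C →
    sum (map (λ u → g (m + size u)) us) ≡ 3
  three-layer (u₁ ∷ u₂ ∷ u₃ ∷ []) _ part total =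
    parts-exact (part (here refl)) (part (there (here refl))) (part (there (there (here refl)))) total
  three-layer []                      () _ _
  three-layer (_ ∷ [])                () _ _
  three-layer (_ ∷ _ ∷ [])            () _ _
  three-layer (_ ∷ _ ∷ _ ∷ _ ∷ _)     () _ _

  heavy-top : ∀ {us} → node us ∈ ts → size (node us) ≡ m → topLayers g (size (node us)) us ≡ 4
  heavy-top {us} t∈ size≡m = trans (cong (λ μ → topLayers g μ us) size≡m) (cong₂ _+_ g-m
    (three-layer us (three-parts size (lam * C) us λC≥1 (part-lower ∘ part) (part-upper ∘ part) (heavy-sum us size≡m))
                 part (heavy-sum us size≡m)))
    where
    part : ∀ {u} → u ∈ us → Part (size u)
    part = heavy-part t∈ size≡m
    λC≥1 : 1 ≤ lam * C
    λC≥1 = *-mono-≤ (≤-trans (s≤s z≤n) lam≥4) (≤-trans (s≤s z≤n) (a-upper some-j))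

  heavy-h : ∀ {us} → node us ∈ ts → size (node us) ≡ m → weight h (size (node us)) (node us) ≡ 1
  heavy-h t∈ size≡m = trans (root-child-h t∈) (trans (cong h size≡m) h-m)

  -- Per root child t, the g-weight dominates four times the h-weight; the
  -- domination keeps a surplus g(q) for any vertex q of t when size t ≢ m,
  -- and for any vertex q of depth ≥ 2 in t when size t ≡ m.
  light-surplus : ∀ {t} → t ∈ ts → size t ≢ m → (q : Pos t) →
    4 * weight h (size t) t + g (labelFrom (size t) q) ≤ weight g (size t) t
  light-surplus {t} t∈ size≢m q =
    subst (λ x → 4 * x + g (labelFrom (size t) q) ≤ weight g (size t) t)
          (sym (trans (root-child-h t∈) (h-off _ size≢m))) (weight-vertex g (size t) q)

  heavy-surplus : ∀ {us} (t∈ : node us ∈ ts) → size (node us) ≡ m → ∀ {u} (u∈ : u ∈ us) (p : Pos u) → NonRoot p →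
    4 * weight h (size (node us)) (node us) + g (labelFrom (size (node us) + size u) p) ≤ weight g (size (node us)) (node us)
  heavy-surplus {us} t∈ size≡m {u} u∈ p nr = begin
    4 * weight h μ (node us) + g (labelFrom (μ + size u) p)
      ≡⟨ cong (λ x → 4 * x + g (labelFrom (μ + size u) p)) (heavy-h t∈ size≡m) ⟩
    4 + g (labelFrom (μ + size u) p)
      ≡⟨ cong (_+ g (labelFrom (μ + size u) p)) (heavy-top t∈ size≡m) ⟨
    topLayers g μ us + g (labelFrom (μ + size u) p)
      ≤⟨ weight-top-deep g μ us u∈ p nr ⟩
    weight g μ (node us) ∎
    where
    open ≤-Reasoning
    μ : ℕ
    μ = size (node us)

  dominated : ∀ {t} → t ∈ ts → 4 * weight h (size t) t ≤ weight g (size t) t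
  dominated {node us} t∈ with size (node us) ≟ m
  ... | no  size≢m = ≤-trans (m≤m+n _ _) (light-surplus t∈ size≢m root)
  ... | yes size≡m = begin
    4 * weight h μ (node us) ≡⟨ cong (4 *_) (heavy-h t∈ size≡m) ⟩
    4                        ≡⟨ heavy-top t∈ size≡m ⟨
    topLayers g μ us         ≤⟨ weight-top g μ us ⟩
    weight g μ (node us)     ∎
    where
    open ≤-Reasoning
    μ : ℕ
    μ = size (node us)

  -- Summed over the root children both sides equal 4n, so there is no surplus.
  no-surplus-at-root : ∀ {t e} → t ∈ ts → 4 * weight h (size t) t + e ≤ weight g (size t) t → e ≡ 0
  no-surplus-at-root = no-surplus (λ t → 4 * weight h (size t) t) (λ t → weight g (size t) t) ts dominated totals
    where
    totals : sum (map (λ t → weight g (size t) t) ts) ≤ sum (map (λ t → 4 * weight h (size t) t) ts)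
    totals = ≤-reflexive (begin
      sum (map (λ t → weight g (size t) t) ts)      ≡⟨ weights-sum g 0 ts ⟨
      weights g 0 ts                                 ≡⟨ cong (_+ weights g 0 ts) g-0 ⟨
      weight g 0 T                                   ≡⟨ g-total ⟩
      4 * n                                          ≡⟨ cong (4 *_) h-total ⟨
      4 * weight h 0 T                               ≡⟨ cong (λ x → 4 * (x + weights h 0 ts)) h-0 ⟩
      4 * weights h 0 ts                             ≡⟨ cong (4 *_) (weights-sum h 0 ts) ⟩
      4 * sum (map (λ t → weight h (size t) t) ts)   ≡⟨ sum-map-scale 4 (λ t → weight h (size t) t) ts ⟨
      sum (map (λ t → 4 * weight h (size t) t) ts)   ∎)
      where open ≡-Reasoning

  below-non-m : (v : Pos T) → NonRoot v → label v ≢ m → ∀ {w} (w∈ : w ∈ children (subtree v)) →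
    g (label (extend v w∈)) ≡ 0
  below-non-m (child {t = node us} t∈ root) _ size≢m {node zs} w∈ =
    no-surplus-at-root t∈ (light-surplus t∈ size≢m (child w∈ root))
  below-non-m (child {t = node us} t∈ (child u∈ r)) _ _ w∈ with size (node us) ≟ m
  ... | no  size≢m = no-surplus-at-root t∈ (light-surplus t∈ size≢m (child u∈ (extend r w∈)))
  ... | yes size≡m = no-surplus-at-root t∈ (heavy-surplus t∈ size≡m u∈ (extend r w∈) (extend-nonroot r w∈))

  step-from-Y : ∀ i s → 1 ≤ s → Allowed (Y i + s) → g (Y i + s) ≡ 0 → (lam ∣ s) × Σ (Fin (3 * n)) (λ k → Y i + s ≡ Y k)
  step-from-Y i s s≥1 (is-m Yi+s≡m) _ = ⊥-elim (<-irrefl (sym Yi+s≡m) (<-≤-trans (m<Y i) (m≤m+n (Y i) s)))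
  step-from-Y i s s≥1 (is-X k Yi+s≡X) g≡0 = ⊥-elim (0≢1+n (trans (sym g≡0) (trans (cong g Yi+s≡X) (g-X k))))
  step-from-Y i s s≥1 (is-Y k Yi+s≡Y) _ = lam∣s , k , Yi+s≡Y
    where
    shift : ∀ l c b s → l * c + l * b + 2 + s ≡ (l * c + 2) + (l * b + s)
    shift = solve-∀
    shiftY : ∀ l c b → l * c + l * b + 2 ≡ (l * c + 2) + l * b
    shiftY = solve-∀
    a-step : lam * a i + s ≡ lam * a k
    a-step = +-cancelˡ-≡ (lam * C + 2) _ _ (trans (sym (shift lam C (a i) s)) (trans Yi+s≡Y (shiftY lam C (a k))))
    lam∣s : lam ∣ s
    lam∣s = ∣m+n∣m⇒∣n (subst (lam ∣_) (sym a-step) (m∣m*n (a k))) (m∣m*n (a i))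

  child-of-Y : (v : Pos T) → NonRoot v → ∀ {i} → label v ≡ Y i → ∀ {w} (w∈ : w ∈ children (subtree v)) →
    (lam ∣ size w) × Σ (Fin (3 * n)) (λ k → label (extend v w∈) ≡ Y k)
  child-of-Y v nr {i} label≡Y {node zs} w∈ = proj₁ step , proj₁ (proj₂ step) , trans label-w (proj₂ (proj₂ step))
    where
    label-w : label (extend v w∈) ≡ Y i + size (node zs)
    label-w = trans (extend-label 0 v w∈) (cong (_+ size (node zs)) label≡Y)
    step : (lam ∣ size (node zs)) × Σ (Fin (3 * n)) (λ k → Y i + size (node zs) ≡ Y k)
    step = step-from-Y i (size (node zs)) (s≤s z≤n)
      (subst Allowed label-w (label-allowed (extend v w∈) (extend-nonroot v w∈)))
      (subst (λ x → g x ≡ 0) label-w (below-non-m v nr (λ label≡m → >⇒≢ (m<Y i) (trans (sym label≡Y) label≡m)) w∈))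

  -- A vertex labelled Y i has no children: a child w would have size
  -- 1 + (sizes of its own children), all multiples of λ ≥ 4.
  Y-childless : (v : Pos T) → NonRoot v → ∀ {i} → label v ≡ Y i → ∀ {w} → w ∈ children (subtree v) → ⊥
  Y-childless v nr label≡Y {node zs} w∈ = <-irrefl (sym (∣1⇒≡1 lam∣1)) (≤-trans (s≤s (s≤s z≤n)) lam≥4)
    where
    w-facts : (lam ∣ size (node zs)) × Σ (Fin (3 * n)) (λ k → label (extend v w∈) ≡ Y k)
    w-facts = child-of-Y v nr label≡Y w∈
    lam∣z : ∀ {z} → z ∈ zs → lam ∣ size z
    lam∣z z∈ = proj₁ (child-of-Y (extend v w∈) (extend-nonroot v w∈) (proj₂ (proj₂ w-facts))
                        (subst (λ x → _ ∈ children x) (sym (extend-subtree v w∈)) z∈))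
    lam∣zs : lam ∣ sizes zs
    lam∣zs = subst (lam ∣_) (sym (sizes-sum zs)) (∣-sum-map lam size zs lam∣z)
    lam∣1 : lam ∣ 1
    lam∣1 = ∣m+n∣m⇒∣n (subst (lam ∣_) (+-comm 1 (sizes zs)) (proj₁ w-facts)) lam∣zs

  Y-vertex-is-leaf : (v : Pos T) → Σ (Fin (3 * n)) (λ i → label v ≡ Y i) → IsLeaf v
  Y-vertex-is-leaf root          (i , 0≡Y) = ⊥-elim (0≢1+n (trans 0≡Y (+-comm _ 2)))
  Y-vertex-is-leaf v@(child _ _) (i , label≡Y) = tt , no-children (children (subtree v)) (Y-childless v tt label≡Y)
    where
    no-children : ∀ (ws : List Tree) → (∀ {w} → w ∈ ws → ⊥) → ws ≡ []
    no-children []      _     = refl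
    no-children (_ ∷ _) empty = ⊥-elim (empty (here refl))

lemma4 : (n C : ℕ) → 1 ≤ n → (a : Fin (3 * n) → ℕ)
         → (∀ i → C < 4 * a i) → (∀ i → 2 * a i < C)
         → ΣFin (3 * n) a ≡ n * C
         → (lam : ℕ) → 3 * n < lam
         → (T : Tree) → (∀ i → 1 ≤ i → avCoeff T i ≡ PCoeff n C a lam i)
         → (v : Pos T) → ∃ (λ i → label v ≡ lam * C + lam * a i + 2)
         → IsLeaf v
lemma4 n C n≥1 a a-lower a-upper _ lam lam>3n (node ts) coeff =
  Avalanche.Y-vertex-is-leaf n C a lam n≥1 a-lower a-upper lam>3n ts coeff
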